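{- Let $n\ge3$ be an integer, let $\mathcal{I}\subseteq\{2,\ldots,n-1\}$, and let $\Gamma$ be the pregraph $2_{\mathcal{I}}^n$ with vertices $u,v$. Let $G$ be a group with distinct non-trivial generators $z,y_2,y_3,\ldots,y_{n-1}$ such that $y_i^2=1_G$ for all $i\in\{2,\ldots,n-1\}$; for $i\in\{3,\ldots,n-1\}$, $y_i^{ -1}zy_i=z$ if $i\in\mathcal{I}$ and $y_i^{ -1}zy_i=z^{ -1}$ if $i\notin\mathcal{I}$; and $y_iy_j=y_jy_i$ whenever $|i-j|>1$. If $\zeta:D(\Gamma)\to G$ is the voltage assignment satisfying $\zeta(u_0)=1_G$, $\zeta(u_1)=z$ and $\zeta(u_i)=\zeta(v_i)=y_i$ for $i\ge2$, then $\mathrm{Cov}(\Gamma,\zeta)$ (with each dart $(x,a)$ coloured by the colour of $x$) is an $n$-maniplex.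
   Context: A pregraph is a tuple $(V,D;\mathrm{beg},\mathrm{inv})$ with disjoint finite sets $V$ (vertices) and $D$ (darts), a map $\mathrm{beg}:D\to V$ and an involution $\mathrm{inv}:D\to D$; orbits of $\mathrm{inv}$ are edges, a semi-edge being a dart $x$ with $\mathrm{inv}(x)=x$. For $\mathcal{I}\subseteq\{0,\ldots,n-1\}$, $2_{\mathcal{I}}^n$ is the coloured pregraph with two vertices $u,v$ and, for each colour $i\in\{0,\ldots,n-1\}$, one dart $u_i$ with $\mathrm{beg}(u_i)=u$ and one dart $v_i$ with $\mathrm{beg}(v_i)=v$, both of colour $i$, where $\mathrm{inv}(u_i)=u_i$, $\mathrm{inv}(v_i)=v_i$ if $i\in\mathcal{I}$ and $\mathrm{inv}(u_i)=v_i$ otherwise. A voltage assignment is a map $\zeta:D\to G$ into a group with $\zeta(\mathrm{inv}\,x)=\zeta(x)^{ -1}$. The derived pregraph $\mathrm{Cov}(\Gamma,\zeta)$ has darts $D\times G$, vertices $V\times G$, $\mathrm{beg}(x,a)=(\mathrm{beg}\,x,a)$ and $\mathrm{inv}(x,a)=(\mathrm{inv}\,x,\zeta(x)a)$. An $n$-maniplex (as a graph) is a connected simple $n$-regular graph with a proper edge-colouring by colours $0,\ldots,n-1$ such that for all colours $i,j$ with $|i-j|\ge2$ the edges of colours $i$ and $j$ induce a disjoint union of $4$-cycles. -}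

module Defs where

open import Level using (Level; _⊔_) renaming (suc to lsuc; zero to lzero)
open import Data.Nat using (ℕ; _≤_; _<_; ∣_-_∣)
open import Data.Fin using (Fin; toℕ)
open import Data.Fin.Subset using (Subset; _∈_; _∉_)
open import Data.Vec using (lookup)
open import Data.Bool using (Bool; true; false; if_then_else_)
open import Data.Product using (Σ; ∃; _×_; _,_)
open import Data.Sum using (_⊎_)
open import Relation.Nullary using (¬_)
open import Relation.Binary using (Rel)
open import Relation.Binary.PropositionalEquality using (_≡_)
open import Algebra.Bundles using (Group)

record Pregraph (n : ℕ) : Set₁ where
  field
    V   : Set
    D   : Set
    beg : D → V
    inv : D → D
    col : D → Fin n

data V2 : Set where
  u v : V2

data D2 (n : ℕ) : Set where
  uD vD : Fin n → D2 n

module _ {n : ℕ} (I : Subset n) where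
  beg2 : D2 n → V2
  beg2 (uD _) = u
  beg2 (vD _) = v

  inv2 : D2 n → D2 n
  inv2 (uD i) = if lookup I i then uD i else vD i
  inv2 (vD i) = if lookup I i then vD i else uD i

  col2 : D2 n → Fin n
  col2 (uD i) = i
  col2 (vD i) = i

two : (n : ℕ) → Subset n → Pregraph n
two n I = record { V = V2 ; D = D2 n ; beg = beg2 I ; inv = inv2 I ; col = col2 I }

-- Coloured pregraphs whose vertex/dart sets carry an equivalence
-- (needed since a group bundle comes with a setoid equality)

record SPregraph (n : ℕ) (c ℓ : Level) : Set (lsuc (c ⊔ ℓ)) where
  field
    V    : Set c
    _≈V_ : Rel V ℓ
    D    : Set c
    _≈D_ : Rel D ℓ
    beg  : D → V
    inv  : D → D
    col  : D → Fin n

module _ {n : ℕ} {c ℓ : Level} (Γ : Pregraph n) (G : Group c ℓ) where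
  open Group G
  open Pregraph Γ

  IsVoltage : (D → Carrier) → Set ℓ
  IsVoltage ζ = ∀ x → ζ (inv x) ≈ (ζ x) ⁻¹

  Cov : (D → Carrier) → SPregraph n c ℓ
  Cov ζ = record
    { V    = V × Carrier
    ; _≈V_ = λ { (p , a) (q , b) → (p ≡ q) × (a ≈ b) }
    ; D    = D × Carrier
    ; _≈D_ = λ { (x , a) (y , b) → (x ≡ y) × (a ≈ b) }
    ; beg  = λ { (x , a) → (beg x , a) }
    ; inv  = λ { (x , a) → (inv x , ζ x ∙ a) }
    ; col  = λ { (x , _) → col x }
    }

module _ {n : ℕ} {c ℓ : Level} (P : SPregraph n c ℓ) where
  open SPregraph P

  data Walk : V → V → Set (c ⊔ ℓ) where
    stop : ∀ {p q} → p ≈V q → Walk p q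
    step : ∀ {p q} (x : D) → beg x ≈V p → Walk (beg (inv x)) q → Walk p q

  record IsManiplex : Set (c ⊔ ℓ) where
    field
      noSemiEdge : ∀ x → ¬ (inv x ≈D x)
      noLoop     : ∀ x → ¬ (beg (inv x) ≈V beg x)
      noParallel : ∀ x y → beg x ≈V beg y → beg (inv x) ≈V beg (inv y) → x ≈D y
      colEdge    : ∀ x → col (inv x) ≡ col x
      colExists  : ∀ p (i : Fin n) → Σ D λ x → (beg x ≈V p) × (col x ≡ i)
      colProper  : ∀ x y → beg x ≈V beg y → col x ≡ col y → x ≈D y
      connected  : ∀ p q → Walk p q
      -- for |i - j| ≥ 2, the i,j-edges form disjoint 4-cycles: every vertex p
      -- lies on a cycle p -i- q -j- r -i- s -j- p with p,q,r,s pairwise distinct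
      -- (by the proper colouring, this cycle is the whole i,j-component of p)
      fourCycles : ∀ (i j : Fin n) → 2 ≤ ∣ toℕ i - toℕ j ∣ → ∀ p →
        Σ D λ x₁ → Σ D λ x₂ → Σ D λ x₃ → Σ D λ x₄ →
          (beg x₁ ≈V p) × (col x₁ ≡ i) ×
          (beg x₂ ≈V beg (inv x₁)) × (col x₂ ≡ j) ×
          (beg x₃ ≈V beg (inv x₂)) × (col x₃ ≡ i) ×
          (beg x₄ ≈V beg (inv x₃)) × (col x₄ ≡ j) ×
          (beg (inv x₄) ≈V p) ×
          ¬ (beg x₁ ≈V beg x₂) × ¬ (beg x₁ ≈V beg x₃) × ¬ (beg x₁ ≈V beg x₄) ×
          ¬ (beg x₂ ≈V beg x₃) × ¬ (beg x₂ ≈V beg x₄) × ¬ (beg x₃ ≈V beg x₄)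

module _ {c ℓ : Level} (G : Group c ℓ) where
  open Group G

  data Gen {s} (S : Carrier → Set s) : Carrier → Set (c ⊔ ℓ ⊔ s) where
    gen  : ∀ {g} → S g → Gen S g
    one  : Gen S ε
    mul  : ∀ {g h} → Gen S g → Gen S h → Gen S (g ∙ h)
    inv⁻¹ : ∀ {g} → Gen S g → Gen S (g ⁻¹)
    resp : ∀ {g h} → g ≈ h → Gen S g → Gen S h

  Generates : ∀ {s} → (Carrier → Set s) → Set (c ⊔ ℓ ⊔ s)
  Generates S = ∀ g → Gen S g

-- The derived graph inherits its local structure from 2ⁿ_I: it has no loops or parallel edges
-- because at each vertex of 2ⁿ_I the darts of distinct colours carry distinct voltages
-- (1, z^±1 and the y_i), and a semi-edge cannot carry the trivial voltage of the 0-edge. It is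
-- connected because the 0-edge joins u and v with trivial voltage and the voltages at u generate G.
-- For |i − j| ≥ 2 the moves along colours i and j are commuting involutions (y_i commutes with y_j,
-- and y_i conjugates z to z^±1 exactly as colour i fixes or swaps u and v), so i,j-alternating walks
-- close after four steps, and simplicity forces these closed walks to be 4-cycles.

module Submission where

open import Defs
open import Level using (Level; _⊔_)
open import Data.Nat using (ℕ; _+_; _≤_; _<_; ∣_-_∣; z≤n; s≤s)
open import Data.Nat.Properties using (∣n-n∣≡0)
open import Data.Fin using (Fin; toℕ; zero; suc)
open import Data.Fin.Properties using (_≟_)
open import Data.Fin.Subset using (Subset; _∈_; _∉_)
open import Data.Vec using (lookup)
open import Data.Vec.Properties using (lookup⇒[]=; []=⇒lookup)
open import Data.Bool using (Bool; true; false)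
open import Data.Product using (Σ; ∃; _×_; _,_; proj₁; proj₂)
open import Data.Sum using (_⊎_; inj₁; inj₂)
open import Data.Empty using (⊥-elim)
open import Relation.Nullary using (¬_)
open import Relation.Nullary.Decidable using (decidable-stable)
open import Relation.Binary.PropositionalEquality as ≡ using (_≡_; _≢_)
open import Algebra.Bundles using (Group)
import Algebra.Properties.Group as GroupProperties
import Relation.Binary.Reasoning.Setoid as SetoidReasoning

module _ {c ℓ : Level} (G : Group c ℓ) where
  open Group G
  open GroupProperties G
  open SetoidReasoning setoid

  conjugate⇒∙-comm : ∀ {g h y} → (y ⁻¹ ∙ g) ∙ y ≈ h → g ∙ y ≈ y ∙ h
  conjugate⇒∙-comm {g} {h} {y} conj = begin
    g ∙ y                ≈⟨ \\-leftDividesˡ y (g ∙ y) ⟨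
    y ∙ (y ⁻¹ ∙ (g ∙ y)) ≈⟨ ∙-congˡ (assoc (y ⁻¹) g y) ⟨
    y ∙ ((y ⁻¹ ∙ g) ∙ y) ≈⟨ ∙-congˡ conj ⟩
    y ∙ h                ∎

  ∙-comm-⁻¹ : ∀ {g h y} → g ∙ y ≈ y ∙ h → g ⁻¹ ∙ y ≈ y ∙ h ⁻¹
  ∙-comm-⁻¹ {g} {h} {y} comm = begin
    g ⁻¹ ∙ y                ≈⟨ ∙-congˡ (//-rightDividesʳ h y) ⟨
    g ⁻¹ ∙ ((y ∙ h) ∙ h ⁻¹) ≈⟨ ∙-congˡ (∙-congʳ comm) ⟨
    g ⁻¹ ∙ ((g ∙ y) ∙ h ⁻¹) ≈⟨ ∙-congˡ (assoc g y (h ⁻¹)) ⟩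
    g ⁻¹ ∙ (g ∙ (y ∙ h ⁻¹)) ≈⟨ \\-leftDividesʳ g (y ∙ h ⁻¹) ⟩
    y ∙ h ⁻¹                ∎

  Gen-mono : ∀ {s t} {S : Carrier → Set s} {T : Carrier → Set t} →
             (∀ {g} → S g → T g) → ∀ {g} → Gen G S g → Gen G T g
  Gen-mono S⊆T (gen s)   = gen (S⊆T s)
  Gen-mono S⊆T one       = one
  Gen-mono S⊆T (mul g h) = mul (Gen-mono S⊆T g) (Gen-mono S⊆T h)
  Gen-mono S⊆T (inv⁻¹ g) = inv⁻¹ (Gen-mono S⊆T g)
  Gen-mono S⊆T (resp e g) = resp e (Gen-mono S⊆T g)

module Cover {n : ℕ} {c ℓ : Level} (Γ : Pregraph n) (G : Group c ℓ)
  (ζ : Pregraph.D Γ → Group.Carrier G) (ζ-voltage : IsVoltage Γ G ζ)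
  (inv-involutive : ∀ x → Pregraph.inv Γ (Pregraph.inv Γ x) ≡ x) where
  open Pregraph Γ
  open Group G
  open GroupProperties G using (\\-leftDividesʳ; identityˡ-unique; ∙-cancelʳ)

  C : SPregraph n c ℓ
  C = Cov Γ G ζ
  module C = SPregraph C

  ≈V-refl : ∀ {p} → p C.≈V p
  ≈V-refl = ≡.refl , refl

  ≈V-sym : ∀ {p q} → p C.≈V q → q C.≈V p
  ≈V-sym (e , f) = ≡.sym e , sym f

  ≈V-trans : ∀ {p q r} → p C.≈V q → q C.≈V r → p C.≈V r
  ≈V-trans (e , f) (e′ , f′) = ≡.trans e e′ , trans f f′

  beg-inv-inv : ∀ x → C.beg (C.inv (C.inv x)) C.≈V C.beg x
  beg-inv-inv (d , a) = ≡.cong beg (inv-involutive d) , (begin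
    ζ (inv d) ∙ (ζ d ∙ a)  ≈⟨ ∙-congʳ (ζ-voltage d) ⟩
    ζ d ⁻¹ ∙ (ζ d ∙ a)     ≈⟨ \\-leftDividesʳ (ζ d) a ⟩
    a                      ∎)
    where open SetoidReasoning setoid

  Walk-respˡ : ∀ {p p′ q} → p C.≈V p′ → Walk C p′ q → Walk C p q
  Walk-respˡ e (stop f)     = stop (≈V-trans e f)
  Walk-respˡ e (step x f w) = step x (≈V-trans f (≈V-sym e)) w

  infixr 5 _++_
  _++_ : ∀ {p q r} → Walk C p q → Walk C q r → Walk C p r
  stop e     ++ w′ = Walk-respˡ e w′
  step x e w ++ w′ = step x e (w ++ w′)

  reverse : ∀ {p q} → Walk C p q → Walk C q p
  reverse (stop e)     = stop (≈V-sym e)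
  reverse (step x e w) = reverse w ++ step (C.inv x) ≈V-refl (stop (≈V-trans (beg-inv-inv x) e))

  Cov-noLoop : (∀ x → beg (inv x) ≡ beg x → ¬ ζ x ≈ ε) →
               ∀ x → ¬ C.beg (C.inv x) C.≈V C.beg x
  Cov-noLoop nontrivial (d , a) (e , f) = nontrivial d e (identityˡ-unique (ζ d) a f)

  Cov-noSemiEdge : (∀ x → ¬ C.beg (C.inv x) C.≈V C.beg x) → ∀ x → ¬ C.inv x C.≈D x
  Cov-noSemiEdge noLoop (d , a) (e , f) = noLoop (d , a) (≡.cong beg e , f)

  Cov-noParallel : (∀ x y → beg x ≡ beg y → beg (inv x) ≡ beg (inv y) → ζ x ≈ ζ y → x ≡ y) →
                   ∀ x y → C.beg x C.≈V C.beg y → C.beg (C.inv x) C.≈V C.beg (C.inv y) → x C.≈D y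
  Cov-noParallel distinct (d , a) (d′ , b) (e , a≈b) (e′ , f) =
    distinct d d′ e e′ (∙-cancelʳ a (ζ d) (ζ d′) (trans f (∙-congˡ (sym a≈b)))) , a≈b

  Cov-colEdge : (∀ x → col (inv x) ≡ col x) → ∀ x → C.col (C.inv x) ≡ C.col x
  Cov-colEdge colEdge (d , a) = colEdge d

  Cov-colExists : (∀ w i → Σ D λ x → (beg x ≡ w) × (col x ≡ i)) →
                  ∀ p i → Σ C.D λ x → (C.beg x C.≈V p) × (C.col x ≡ i)
  Cov-colExists exists (w , a) i with exists w i
  ... | d , e , f = (d , a) , (e , refl) , f

  Cov-colProper : (∀ x y → beg x ≡ beg y → col x ≡ col y → x ≡ y) →
                  ∀ x y → C.beg x C.≈V C.beg y → C.col x ≡ C.col y → x C.≈D y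
  Cov-colProper proper (d , a) (d′ , b) (e , a≈b) f = proper d d′ e f , a≈b

  adjacent-distinct : (∀ x → ¬ C.beg (C.inv x) C.≈V C.beg x) →
                      ∀ {x y} → C.beg y C.≈V C.beg (C.inv x) → ¬ C.beg x C.≈V C.beg y
  adjacent-distinct noLoop {x} yx xy = noLoop x (≈V-trans (≈V-sym yx) (≈V-sym xy))

  -- Two steps of different colours cannot return to the start: the two edges would be parallel.
  opposite-distinct : (∀ x y → C.beg x C.≈V C.beg y → C.beg (C.inv x) C.≈V C.beg (C.inv y) → x C.≈D y) →
                      (∀ x → col (inv x) ≡ col x) →
                      ∀ {i j x y z} → i ≢ j → C.col x ≡ i → C.col y ≡ j →
                      C.beg y C.≈V C.beg (C.inv x) → C.beg z C.≈V C.beg (C.inv y) → ¬ C.beg x C.≈V C.beg z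
  opposite-distinct noParallel colEdge {x = x , a} {y , b} i≢j ≡i ≡j yx zy xz
    with noParallel (C.inv (x , a)) (y , b) (≈V-sym yx)
           (≈V-trans (beg-inv-inv (x , a)) (≈V-trans xz zy))
  ... | x≡y , _ = i≢j (≡.trans (≡.sym ≡i) (≡.trans (≡.sym (colEdge x)) (≡.trans (≡.cong col x≡y) ≡j)))

flip : V2 → V2
flip u = v
flip v = u

flip-≢ : ∀ w → flip w ≢ w
flip-≢ u ()
flip-≢ v ()

flipUnless : Bool → V2 → V2
flipUnless true  w = w
flipUnless false w = flip w

flipUnless-involutive : ∀ b w → flipUnless b (flipUnless b w) ≡ w
flipUnless-involutive true  w = ≡.refl
flipUnless-involutive false u = ≡.refl
flipUnless-involutive false v = ≡.refl

flipUnless-comm : ∀ b b′ w → flipUnless b (flipUnless b′ w) ≡ flipUnless b′ (flipUnless b w)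
flipUnless-comm true  b′    w = ≡.refl
flipUnless-comm false true  w = ≡.refl
flipUnless-comm false false w = ≡.refl

module _ {n : ℕ} (I : Subset n) where

  dartAt : V2 → Fin n → D2 n
  dartAt u k = uD k
  dartAt v k = vD k

  neighbour : Fin n → V2 → V2
  neighbour k = flipUnless (lookup I k)

  beg-dartAt : ∀ w k → beg2 I (dartAt w k) ≡ w
  beg-dartAt u k = ≡.refl
  beg-dartAt v k = ≡.refl

  col-dartAt : ∀ w k → col2 I (dartAt w k) ≡ k
  col-dartAt u k = ≡.refl
  col-dartAt v k = ≡.refl

  inv-dartAt : ∀ w k → inv2 I (dartAt w k) ≡ dartAt (neighbour k w) k
  inv-dartAt u k with lookup I k
  ... | true  = ≡.refl
  ... | false = ≡.refl
  inv-dartAt v k with lookup I k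
  ... | true  = ≡.refl
  ... | false = ≡.refl

  beg-inv-dartAt : ∀ w k → beg2 I (inv2 I (dartAt w k)) ≡ neighbour k w
  beg-inv-dartAt w k = ≡.trans (≡.cong (beg2 I) (inv-dartAt w k)) (beg-dartAt (neighbour k w) k)

  inv-inv-dartAt : ∀ w k → inv2 I (inv2 I (dartAt w k)) ≡ dartAt w k
  inv-inv-dartAt w k = begin
    inv2 I (inv2 I (dartAt w k))                ≡⟨ ≡.cong (inv2 I) (inv-dartAt w k) ⟩
    inv2 I (dartAt (neighbour k w) k)           ≡⟨ inv-dartAt _ k ⟩
    dartAt (neighbour k (neighbour k w)) k      ≡⟨ ≡.cong (λ w′ → dartAt w′ k) (flipUnless-involutive (lookup I k) w) ⟩
    dartAt w k                                  ∎
    where open ≡.≡-Reasoning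

  inv2-involutive : ∀ d → inv2 I (inv2 I d) ≡ d
  inv2-involutive (uD k) = inv-inv-dartAt u k
  inv2-involutive (vD k) = inv-inv-dartAt v k

  col-inv2 : ∀ d → col2 I (inv2 I d) ≡ col2 I d
  col-inv2 (uD k) = ≡.trans (≡.cong (col2 I) (inv-dartAt u k)) (col-dartAt (neighbour k u) k)
  col-inv2 (vD k) = ≡.trans (≡.cong (col2 I) (inv-dartAt v k)) (col-dartAt (neighbour k v) k)

  neighbour≡⇒∈ : ∀ w k → neighbour k w ≡ w → k ∈ I
  neighbour≡⇒∈ w k loop with lookup I k in eq
  ... | true  = lookup⇒[]= k I eq
  ... | false = ⊥-elim (flip-≢ w loop)

  lookup≡false⇒∉ : ∀ {k} → lookup I k ≡ false → k ∉ I
  lookup≡false⇒∉ eq k∈I with ≡.trans (≡.sym ([]=⇒lookup k∈I)) eq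
  ... | ()

  neighbour-∉ : ∀ {k} → k ∉ I → ∀ w → neighbour k w ≡ flip w
  neighbour-∉ {k} k∉I w with lookup I k in eq
  ... | true  = ⊥-elim (k∉I (lookup⇒[]= k I eq))
  ... | false = ≡.refl

module TwoCover {n : ℕ} {c ℓ : Level} (I : Subset n) (G : Group c ℓ)
  (ζ : D2 n → Group.Carrier G) (ζ-voltage : IsVoltage (two n I) G ζ) where
  open Group G
  open GroupProperties G using (ε⁻¹≈ε; \\-leftDividesˡ; \\-leftDividesʳ; //-rightDividesˡ)
  open SetoidReasoning setoid hiding (stop)
  open Cover (two n I) G ζ ζ-voltage (inv2-involutive I)

  ζ-at : V2 → Fin n → Carrier
  ζ-at w k = ζ (dartAt I w k)

  ζ-at-neighbour : ∀ w k → ζ-at (neighbour I k w) k ≈ ζ-at w k ⁻¹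
  ζ-at-neighbour w k = ≡.subst (λ d → ζ d ≈ ζ-at w k ⁻¹) (inv-dartAt I w k) (ζ-voltage (dartAt I w k))

  ζ-at-v : ∀ {k} → k ∉ I → ζ-at v k ≈ ζ-at u k ⁻¹
  ζ-at-v {k} k∉I = ≡.subst (λ w → ζ-at w k ≈ ζ-at u k ⁻¹) (neighbour-∉ I k∉I u) (ζ-at-neighbour u k)

  dart : Fin n → C.V → C.D
  dart k (w , a) = dartAt I w k , a

  next : Fin n → C.V → C.V
  next k (w , a) = neighbour I k w , ζ-at w k ∙ a

  beg-dart : ∀ k p → C.beg (dart k p) C.≈V p
  beg-dart k (w , a) = beg-dartAt I w k , refl

  col-dart : ∀ k p → C.col (dart k p) ≡ k
  col-dart k (w , a) = col-dartAt I w k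

  beg-inv-dart : ∀ k p → C.beg (C.inv (dart k p)) C.≈V next k p
  beg-inv-dart k (w , a) = beg-inv-dartAt I w k , refl

  next-cong : ∀ k {p q} → p C.≈V q → next k p C.≈V next k q
  next-cong k (≡.refl , a≈b) = ≡.refl , ∙-congˡ a≈b

  next-involutive : ∀ k p → next k (next k p) C.≈V p
  next-involutive k (w , a) = flipUnless-involutive (lookup I k) w , (begin
    ζ-at (neighbour I k w) k ∙ (ζ-at w k ∙ a) ≈⟨ ∙-congʳ (ζ-at-neighbour w k) ⟩
    ζ-at w k ⁻¹ ∙ (ζ-at w k ∙ a)              ≈⟨ \\-leftDividesʳ (ζ-at w k) a ⟩
    a                                         ∎)

  CommutingAt : Fin n → Fin n → Set ℓ
  CommutingAt i j = ∀ w → ζ-at (neighbour I j w) i ∙ ζ-at w j ≈ ζ-at (neighbour I i w) j ∙ ζ-at w i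

  next-comm : ∀ {i j} → CommutingAt i j → ∀ p → next i (next j p) C.≈V next j (next i p)
  next-comm {i} {j} comm (w , a) = flipUnless-comm (lookup I i) (lookup I j) w , (begin
    ζ-at (neighbour I j w) i ∙ (ζ-at w j ∙ a)  ≈⟨ assoc _ _ a ⟨
    (ζ-at (neighbour I j w) i ∙ ζ-at w j) ∙ a  ≈⟨ ∙-congʳ (comm w) ⟩
    (ζ-at (neighbour I i w) j ∙ ζ-at w i) ∙ a  ≈⟨ assoc _ _ a ⟩
    ζ-at (neighbour I i w) j ∙ (ζ-at w i ∙ a)  ∎)

  square-closes : ∀ {i j} → CommutingAt i j → ∀ p → next j (next i (next j (next i p))) C.≈V p
  square-closes {i} {j} comm p =
    ≈V-trans (next-cong j (next-comm comm (next i p)))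
      (≈V-trans (next-involutive j (next i (next i p))) (next-involutive i p))

  module _ (ζ-at-injective : ∀ w k k′ → ζ-at w k ≈ ζ-at w k′ → k ≡ k′)
           (commuting : ∀ i j → 2 ≤ ∣ toℕ i - toℕ j ∣ → CommutingAt i j)
           (k₀ : Fin n) (k₀∉I : k₀ ∉ I) (ζ-at-k₀ : ζ-at u k₀ ≈ ε)
           (generated : Generates G (λ g → ∃ λ k → g ≈ ζ-at u k)) where

    ζ-at-k₀-trivial : ∀ w → ζ-at w k₀ ≈ ε
    ζ-at-k₀-trivial u = ζ-at-k₀
    ζ-at-k₀-trivial v = trans (ζ-at-v k₀∉I) (trans (⁻¹-cong ζ-at-k₀) ε⁻¹≈ε)

    -- A trivial voltage would make k the colour k₀, which is not a semi-edge colour.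
    semiEdge-nontrivial : ∀ w k → neighbour I k w ≡ w → ¬ ζ-at w k ≈ ε
    semiEdge-nontrivial w k loop trivial =
      k₀∉I (≡.subst (_∈ I) (ζ-at-injective w k k₀ (trans trivial (sym (ζ-at-k₀-trivial w)))) (neighbour≡⇒∈ I w k loop))

    noLoop : ∀ x → ¬ C.beg (C.inv x) C.≈V C.beg x
    noLoop = Cov-noLoop λ where
      (uD k) loop → semiEdge-nontrivial u k (≡.trans (≡.sym (beg-inv-dartAt I u k)) loop)
      (vD k) loop → semiEdge-nontrivial v k (≡.trans (≡.sym (beg-inv-dartAt I v k)) loop)

    noParallel : ∀ x y → C.beg x C.≈V C.beg y → C.beg (C.inv x) C.≈V C.beg (C.inv y) → x C.≈D y
    noParallel = Cov-noParallel λ where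
      (uD k) (uD k′) _ _ e → ≡.cong uD (ζ-at-injective u k k′ e)
      (vD k) (vD k′) _ _ e → ≡.cong vD (ζ-at-injective v k k′ e)
      (uD _) (vD _) () _ _
      (vD _) (uD _) () _ _

    along : ∀ k w a → Walk C (w , a) (next k (w , a))
    along k w a = step (dart k (w , a)) (beg-dart k (w , a)) (stop (beg-inv-dart k (w , a)))

    toBase : ∀ w a → Walk C (w , a) (u , a)
    toBase u a = stop ≈V-refl
    toBase v a = along k₀ v a ++ stop (neighbour-∉ I k₀∉I v , trans (∙-congʳ (ζ-at-k₀-trivial v)) (identityˡ a))

    Reachable : Carrier → Set (c ⊔ ℓ)
    Reachable g = ∀ a → Walk C (u , a) (u , g ∙ a)

    reachable : ∀ {g} → Gen G (λ g → ∃ λ k → g ≈ ζ-at u k) g → Reachable g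
    reachable (gen (k , g≈ζ)) a = along k u a ++ toBase _ _ ++ stop (≡.refl , ∙-congʳ (sym g≈ζ))
    reachable one a = stop (≡.refl , sym (identityˡ a))
    reachable (mul {g} {h} g∈ h∈) a =
      reachable h∈ a ++ reachable g∈ (h ∙ a) ++ stop (≡.refl , sym (assoc g h a))
    reachable (inv⁻¹ {g} g∈) a =
      Walk-respˡ (≡.refl , sym (\\-leftDividesˡ g a)) (reverse (reachable g∈ (g ⁻¹ ∙ a)))
    reachable (resp g≈h g∈) a = reachable g∈ a ++ stop (≡.refl , ∙-congʳ g≈h)

    connected : ∀ p q → Walk C p q
    connected (w , a) (w′ , b) =
      toBase w a ++ reachable (generated (b ∙ a ⁻¹)) a
        ++ Walk-respˡ (≡.refl , //-rightDividesˡ a b) (reverse (toBase w′ b))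

    isManiplex : IsManiplex C
    isManiplex .IsManiplex.noSemiEdge = Cov-noSemiEdge noLoop
    isManiplex .IsManiplex.noLoop     = noLoop
    isManiplex .IsManiplex.noParallel = noParallel
    isManiplex .IsManiplex.colEdge    = Cov-colEdge (col-inv2 I)
    isManiplex .IsManiplex.colExists  = Cov-colExists λ w i → dartAt I w i , beg-dartAt I w i , col-dartAt I w i
    isManiplex .IsManiplex.colProper  = Cov-colProper λ where
      (uD k) (uD _) _ ≡.refl → ≡.refl
      (vD k) (vD _) _ ≡.refl → ≡.refl
      (uD _) (vD _) () _
      (vD _) (uD _) () _
    isManiplex .IsManiplex.connected  = connected
    isManiplex .IsManiplex.fourCycles i j gap p =
      dart i p , dart j p₁ , dart i p₂ , dart j p₃ ,
      beg-dart i p , col-dart i p , link i j p , col-dart j p₁ , link j i p₁ , col-dart i p₂ , link i j p₂ , col-dart j p₃ ,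
      closes ,
      adjacent-distinct noLoop (link i j p) ,
      opposite-distinct noParallel (col-inv2 I) i≢j (col-dart i p) (col-dart j p₁) (link i j p) (link j i p₁) ,
      (λ x₁≈x₄ → adjacent-distinct noLoop (≈V-trans (beg-dart i p) (≈V-sym closes)) (≈V-sym x₁≈x₄)) ,
      adjacent-distinct noLoop (link j i p₁) ,
      opposite-distinct noParallel (col-inv2 I) (λ j≡i → i≢j (≡.sym j≡i)) (col-dart j p₁) (col-dart i p₂) (link j i p₁) (link i j p₂) ,
      adjacent-distinct noLoop (link i j p₂)
      where
      p₁ p₂ p₃ : C.V
      p₁ = next i p
      p₂ = next j p₁
      p₃ = next i p₂

      link : ∀ k l q → C.beg (dart l (next k q)) C.≈V C.beg (C.inv (dart k q))
      link k l q = ≈V-trans (beg-dart l (next k q)) (≈V-sym (beg-inv-dart k q))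

      closes : C.beg (C.inv (dart j p₃)) C.≈V p
      closes = ≈V-trans (beg-inv-dart j p₃) (square-closes (commuting i j gap) p)

      i≢j : i ≢ j
      i≢j ≡.refl with ≡.subst (2 ≤_) (∣n-n∣≡0 (toℕ i)) gap
      ... | ()

module Prescribed {m : ℕ} {c ℓ : Level} (I : Subset (2 + m)) (I≥2 : ∀ i → i ∈ I → 2 ≤ toℕ i)
  (G : Group c ℓ) (z : Group.Carrier G) (y : Fin (2 + m) → Group.Carrier G) where
  open Group G
  open GroupProperties G using (ε⁻¹≈ε; ⁻¹-involutive; ⁻¹-injective; inverseˡ-unique)
  open SetoidReasoning setoid

  2≤toℕ : ∀ {k : Fin m} → 2 ≤ toℕ (suc (suc k))
  2≤toℕ = s≤s (s≤s z≤n)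

  0∉I : zero ∉ I
  0∉I 0∈I with I≥2 zero 0∈I
  ... | ()

  1∉I : suc zero ∉ I
  1∉I 1∈I with I≥2 (suc zero) 1∈I
  ... | s≤s ()

  -- The voltage of colour 1 at v is forced to be z⁻¹ by ζ(u₁) = z, since 1 ∉ I.
  z-at : V2 → Carrier
  z-at u = z
  z-at v = z ⁻¹

  ζ₀ : V2 → Fin (2 + m) → Carrier
  ζ₀ w zero          = ε
  ζ₀ w (suc zero)    = z-at w
  ζ₀ w (suc (suc k)) = y (suc (suc k))

  module _ (z≉ε : ¬ z ≈ ε) (y≉ε : ∀ i → 2 ≤ toℕ i → ¬ y i ≈ ε) (z≉y : ∀ i → 2 ≤ toℕ i → ¬ z ≈ y i)
           (y-injective : ∀ i j → 2 ≤ toℕ i → 2 ≤ toℕ j → i ≢ j → ¬ y i ≈ y j)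
           (y-involution : ∀ i → 2 ≤ toℕ i → y i ∙ y i ≈ ε) where

    z-at≉ε : ∀ w → ¬ z-at w ≈ ε
    z-at≉ε u = z≉ε
    z-at≉ε v z⁻¹≈ε = z≉ε (⁻¹-injective (trans z⁻¹≈ε (sym ε⁻¹≈ε)))

    z-at≉y : ∀ w (k : Fin m) → ¬ z-at w ≈ y (suc (suc k))
    z-at≉y u k = z≉y _ 2≤toℕ
    z-at≉y v k z⁻¹≈y = z≉y _ 2≤toℕ (⁻¹-injective (trans z⁻¹≈y (inverseˡ-unique _ _ (y-involution _ 2≤toℕ))))

    ζ₀-injective : ∀ w k k′ → ζ₀ w k ≈ ζ₀ w k′ → k ≡ k′
    ζ₀-injective w zero          zero           _ = ≡.refl
    ζ₀-injective w zero          (suc zero)     e = ⊥-elim (z-at≉ε w (sym e))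
    ζ₀-injective w zero          (suc (suc k′)) e = ⊥-elim (y≉ε _ 2≤toℕ (sym e))
    ζ₀-injective w (suc zero)    zero           e = ⊥-elim (z-at≉ε w e)
    ζ₀-injective w (suc zero)    (suc zero)     _ = ≡.refl
    ζ₀-injective w (suc zero)    (suc (suc k′)) e = ⊥-elim (z-at≉y w k′ e)
    ζ₀-injective w (suc (suc k)) zero           e = ⊥-elim (y≉ε _ 2≤toℕ e)
    ζ₀-injective w (suc (suc k)) (suc zero)     e = ⊥-elim (z-at≉y w k (sym e))
    ζ₀-injective w (suc (suc k)) (suc (suc k′)) e =
      decidable-stable (_ ≟ _) λ k≢k′ → y-injective _ _ 2≤toℕ 2≤toℕ k≢k′ e

  module _ (y-centralises : ∀ i → 3 ≤ toℕ i → i ∈ I → (y i ⁻¹ ∙ z) ∙ y i ≈ z)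
           (y-inverts : ∀ i → 3 ≤ toℕ i → i ∉ I → (y i ⁻¹ ∙ z) ∙ y i ≈ z ⁻¹)
           (y-commute : ∀ i j → 2 ≤ toℕ i → 2 ≤ toℕ j → 1 < ∣ toℕ i - toℕ j ∣ → y i ∙ y j ≈ y j ∙ y i) where

    z-at-conjugation : ∀ j → 3 ≤ toℕ j → ∀ w → z-at (neighbour I j w) ∙ y j ≈ y j ∙ z-at w
    z-at-conjugation j j≥3 w with lookup I j in j?I
    z-at-conjugation j j≥3 u | true  = conjugate⇒∙-comm G (y-centralises j j≥3 (lookup⇒[]= j I j?I))
    z-at-conjugation j j≥3 v | true  = ∙-comm-⁻¹ G (conjugate⇒∙-comm G (y-centralises j j≥3 (lookup⇒[]= j I j?I)))
    z-at-conjugation j j≥3 u | false =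
      trans (∙-comm-⁻¹ G (conjugate⇒∙-comm G (y-inverts j j≥3 (lookup≡false⇒∉ I j?I)))) (∙-congˡ (⁻¹-involutive z))
    z-at-conjugation j j≥3 v | false = conjugate⇒∙-comm G (y-inverts j j≥3 (lookup≡false⇒∉ I j?I))

    ζ₀-commute : ∀ i j → 2 ≤ ∣ toℕ i - toℕ j ∣ → ∀ w →
                 ζ₀ (neighbour I j w) i ∙ ζ₀ w j ≈ ζ₀ (neighbour I i w) j ∙ ζ₀ w i
    ζ₀-commute zero          zero           ()
    ζ₀-commute zero          (suc zero)     (s≤s ())
    ζ₀-commute zero          (suc (suc j))  _         w = trans (identityˡ _) (sym (identityʳ _))
    ζ₀-commute (suc zero)    zero           (s≤s ())
    ζ₀-commute (suc zero)    (suc zero)     ()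
    ζ₀-commute (suc zero)    (suc (suc j))  (s≤s gap) w = z-at-conjugation _ (s≤s (s≤s gap)) w
    ζ₀-commute (suc (suc i)) zero           _         w = trans (identityʳ _) (sym (identityˡ _))
    ζ₀-commute (suc (suc i)) (suc zero)     (s≤s gap) w = sym (z-at-conjugation _ (s≤s (s≤s gap)) w)
    ζ₀-commute (suc (suc i)) (suc (suc j))  gap       w = y-commute _ _ 2≤toℕ 2≤toℕ gap

  module Assignment (ζ : D2 (2 + m) → Carrier) (ζ-voltage : IsVoltage (two (2 + m) I) G ζ)
           (ζ-0 : ∀ i → toℕ i ≡ 0 → ζ (uD i) ≈ ε) (ζ-1 : ∀ i → toℕ i ≡ 1 → ζ (uD i) ≈ z)
           (ζ-≥2 : ∀ i → 2 ≤ toℕ i → (ζ (uD i) ≈ y i) × (ζ (vD i) ≈ y i)) where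
    open TwoCover I G ζ ζ-voltage

    ζ-at≈ζ₀ : ∀ w k → ζ-at w k ≈ ζ₀ w k
    ζ-at≈ζ₀ u zero          = ζ-0 zero ≡.refl
    ζ-at≈ζ₀ v zero          = trans (ζ-at-v 0∉I) (trans (⁻¹-cong (ζ-0 zero ≡.refl)) ε⁻¹≈ε)
    ζ-at≈ζ₀ u (suc zero)    = ζ-1 (suc zero) ≡.refl
    ζ-at≈ζ₀ v (suc zero)    = trans (ζ-at-v 1∉I) (⁻¹-cong (ζ-1 (suc zero) ≡.refl))
    ζ-at≈ζ₀ u (suc (suc k)) = proj₁ (ζ-≥2 _ 2≤toℕ)
    ζ-at≈ζ₀ v (suc (suc k)) = proj₂ (ζ-≥2 _ 2≤toℕ)

    ζ-at-injective : (∀ w k k′ → ζ₀ w k ≈ ζ₀ w k′ → k ≡ k′) →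
                     ∀ w k k′ → ζ-at w k ≈ ζ-at w k′ → k ≡ k′
    ζ-at-injective ζ₀-inj w k k′ e = ζ₀-inj w k k′ (trans (sym (ζ-at≈ζ₀ w k)) (trans e (ζ-at≈ζ₀ w k′)))

    ζ-at-commuting : (∀ i j → 2 ≤ ∣ toℕ i - toℕ j ∣ → ∀ w →
                       ζ₀ (neighbour I j w) i ∙ ζ₀ w j ≈ ζ₀ (neighbour I i w) j ∙ ζ₀ w i) →
                     ∀ i j → 2 ≤ ∣ toℕ i - toℕ j ∣ → CommutingAt i j
    ζ-at-commuting ζ₀-comm i j gap w = begin
      ζ-at (neighbour I j w) i ∙ ζ-at w j  ≈⟨ ∙-cong (ζ-at≈ζ₀ _ i) (ζ-at≈ζ₀ w j) ⟩
      ζ₀ (neighbour I j w) i ∙ ζ₀ w j      ≈⟨ ζ₀-comm i j gap w ⟩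
      ζ₀ (neighbour I i w) j ∙ ζ₀ w i      ≈⟨ ∙-cong (ζ-at≈ζ₀ _ j) (ζ-at≈ζ₀ w i) ⟨
      ζ-at (neighbour I i w) j ∙ ζ-at w i  ∎

    generated-by-ζ-at-u : Generates G (λ g → (g ≈ z) ⊎ ∃ λ i → (2 ≤ toℕ i) × (g ≈ y i)) →
                          Generates G (λ g → ∃ λ k → g ≈ ζ-at u k)
    generated-by-ζ-at-u generated g = Gen-mono G generator (generated g)
      where
      generator : ∀ {g} → (g ≈ z) ⊎ (∃ λ i → (2 ≤ toℕ i) × (g ≈ y i)) → ∃ λ k → g ≈ ζ-at u k
      generator (inj₁ g≈z)            = suc zero , trans g≈z (sym (ζ-1 (suc zero) ≡.refl))
      generator (inj₂ (i , i≥2 , g≈y)) = i , trans g≈y (sym (proj₁ (ζ-≥2 i i≥2)))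

proposition14 : ∀ {c ℓ : Level} (n : ℕ) → 3 ≤ n →
    (I : Subset n) → (∀ i → i ∈ I → 2 ≤ toℕ i) →
    (G : Group c ℓ) → (z : Group.Carrier G) → (y : Fin n → Group.Carrier G) →
    let open Group G in
    Generates G (λ g → (g ≈ z) ⊎ ∃ λ i → (2 ≤ toℕ i) × (g ≈ y i)) →
    ¬ (z ≈ ε) →
    (∀ i → 2 ≤ toℕ i → ¬ (y i ≈ ε)) →
    (∀ i → 2 ≤ toℕ i → ¬ (z ≈ y i)) →
    (∀ i j → 2 ≤ toℕ i → 2 ≤ toℕ j → ¬ (i ≡ j) → ¬ (y i ≈ y j)) →
    (∀ i → 2 ≤ toℕ i → y i ∙ y i ≈ ε) →
    (∀ i → 3 ≤ toℕ i → i ∈ I → (y i ⁻¹ ∙ z) ∙ y i ≈ z) →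
    (∀ i → 3 ≤ toℕ i → i ∉ I → (y i ⁻¹ ∙ z) ∙ y i ≈ z ⁻¹) →
    (∀ i j → 2 ≤ toℕ i → 2 ≤ toℕ j → 1 < ∣ toℕ i - toℕ j ∣ → y i ∙ y j ≈ y j ∙ y i) →
    (ζ : D2 n → Carrier) → IsVoltage (two n I) G ζ →
    (∀ i → toℕ i ≡ 0 → ζ (uD i) ≈ ε) →
    (∀ i → toℕ i ≡ 1 → ζ (uD i) ≈ z) →
    (∀ i → 2 ≤ toℕ i → (ζ (uD i) ≈ y i) × (ζ (vD i) ≈ y i)) →
    IsManiplex (Cov (two n I) G ζ)
proposition14 _ (s≤s (s≤s (s≤s _))) I I≥2 G z y generated z≉ε y≉ε z≉y y-injective y-involution
              y-centralises y-inverts y-commute ζ ζ-voltage ζ-0 ζ-1 ζ-≥2 =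
  isManiplex (ζ-at-injective (ζ₀-injective z≉ε y≉ε z≉y y-injective y-involution))
             (ζ-at-commuting (ζ₀-commute y-centralises y-inverts y-commute))
             zero 0∉I (ζ-0 zero ≡.refl) (generated-by-ζ-at-u generated)
  where
  open Prescribed I I≥2 G z y
  open Assignment ζ ζ-voltage ζ-0 ζ-1 ζ-≥2
  open TwoCover I G ζ ζ-voltage
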